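{- Let $\mathcal{H}$ be a hypergraph with $|V(\mathcal{H})|=n$ and let $r,s,C,q$ be positive integers with $r,s\geq 2$. For a bijection $\sigma:[n]\to V(\mathcal{H})$, let $\mathcal{T}=\mathcal{T}_{\mathcal{H},C,s,\sigma}$ be the hypergraph with vertex set $V(\mathcal{H})$ and edge set $$E(\mathcal{T})=\bigl\{M\subseteq V(\mathcal{H}): M\neq\varnothing \text{ and } |M|-\operatorname{alt}_s(\mathcal{H}[M],\sigma_M,q)>(s-1)C\bigr\}.$$ Then for every bijection $\sigma:[n]\to V(\mathcal{H})$, $$\operatorname{alt}_r(\mathcal{T},\sigma,1)\leq r(s-1)C+\operatorname{alt}_{rs}(\mathcal{H},\sigma,q).$$
   Context: For $S\subseteq V(\mathcal{H})$, $\mathcal{H}[S]$ is the induced subhypergraph on $S$ (edges of $\mathcal{H}$ contained in $S$). For an $m$-set $M\subseteq V(\mathcal{H})$ with $\sigma^{ -1}(M)=\{i_1<\dots<i_m\}$, $\sigma_M:[m]\to M$ is the bijection $j\mapsto\sigma(i_j)$. Alternation number: for $p\ge2$ let $\mathbb{Z}_p=\{\omega^1,\dots,\omega^p\}$ be cyclic of order $p$. For $X=(x_1,\dots,x_N)\in(\mathbb{Z}_p\cup\{0\})^N$, $\operatorname{alt}(X)$ is the maximum length of a subsequence $x_{i_1},\dots,x_{i_k}$ ($i_1<\dots<i_k$) of nonzero entries with consecutive terms distinct ($\operatorname{alt}(0,\dots,0)=0$), and $X^i=\{j: x_j=\omega^i\}$. For a hypergraph $\mathcal{G}$ with $|V(\mathcal{G})|=N$,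 a bijection $\tau:[N]\to V(\mathcal{G})$ and a positive integer $q$, $\operatorname{alt}_p(\mathcal{G},\tau,q)=\max\{\operatorname{alt}(X): X\in(\mathbb{Z}_p\cup\{0\})^N,\ |E(\mathcal{G}[\tau(X^i)])|\leq q-1\ \forall i\in[p]\}$. -}

module Defs where

open import Data.Nat using (ℕ; zero; suc; _+_; _*_; _∸_; _⊔_; _<ᵇ_; _≡ᵇ_)
open import Data.Bool using (Bool; true; false; _∧_; _∨_; not; if_then_else_)
open import Data.Fin using (Fin; zero; suc; _≟_)
open import Data.Fin.Subset using (Subset; inside; outside; ∣_∣)
open import Data.Vec using (Vec; []; _∷_; lookup; tabulate; toList)
open import Data.List using (List; []; _∷_; map; concatMap; foldr; filterᵇ; length; allFin)
open import Data.Bool.ListAction using (all; any)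
open import Data.Maybe using (Maybe; just; nothing)
open import Relation.Nullary using (does)
open import Function.Bundles using (_⤖_; Bijection)

-- A hypergraph with vertex set Fin n (V(H) identified with Fin n);
-- its edge set is given by a decidable (Bool-valued) predicate on subsets.
record Hypergraph (n : ℕ) : Set where
  field
    isEdge : Subset n → Bool
open Hypergraph public

allSubsets : (n : ℕ) → List (Subset n)
allSubsets zero = [] ∷ []
allSubsets (suc n) = concatMap (λ S → (inside ∷ S) ∷ (outside ∷ S) ∷ []) (allSubsets n)

_⊆ᵇ_ : ∀ {n} → Subset n → Subset n → Bool
[] ⊆ᵇ [] = true
(a ∷ A) ⊆ᵇ (b ∷ B) = (not a ∨ b) ∧ (A ⊆ᵇ B)

numEdgesIn : ∀ {n} → Hypergraph n → Subset n → ℕ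
numEdgesIn H S = length (filterᵇ (λ T → isEdge H T ∧ (T ⊆ᵇ S)) (allSubsets _))

induced : ∀ {n} → Hypergraph n → Subset n → Hypergraph n
induced H S = record { isEdge = λ T → isEdge H T ∧ (T ⊆ᵇ S) }

image : ∀ {N n} → (Fin N → Fin n) → Subset N → Subset n
image {N} τ S = tabulate λ v → any (λ j → lookup S j ∧ does (τ j ≟ v)) (allFin N)

preimage : ∀ {N n} → (Fin N → Fin n) → Subset n → Subset N
preimage τ M = tabulate λ i → lookup M (τ i)

elems : ∀ {n} → Subset n → List (Fin n)
elems [] = []
elems (true ∷ S) = zero ∷ map suc (elems S)
elems (false ∷ S) = map suc (elems S)

-- σ_M : [m] → M,  j ↦ σ(i_j) where σ⁻¹(M) = {i_1 < … < i_m}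
restrictBij : ∀ {n} → (σ : Fin n → Fin n) → (M : Subset n) →
              Fin (length (elems (preimage σ M))) → Fin n
restrictBij σ M j = σ (Data.List.lookup (elems (preimage σ M)) j)

-- alt(X): maximum length of a subsequence of nonzero entries with
-- consecutive terms distinct (nothing = 0, just i = ω^(i+1)).
-- altFrom last xs = max length of such a subsequence of xs whose first
-- term differs from `last` (if last = just c).
altFrom : ∀ {p} → Maybe (Fin p) → List (Maybe (Fin p)) → ℕ
altFrom last [] = 0
altFrom last (nothing ∷ xs) = altFrom last xs
altFrom nothing (just c ∷ xs) = altFrom nothing xs ⊔ suc (altFrom (just c) xs)
altFrom (just d) (just c ∷ xs) =
  if does (c ≟ d) then altFrom (just d) xs
  else (altFrom (just d) xs ⊔ suc (altFrom (just c) xs))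

alt : ∀ {p N} → Vec (Maybe (Fin p)) N → ℕ
alt X = altFrom nothing (toList X)

allVecs : ∀ {A : Set} → (N : ℕ) → List A → List (Vec A N)
allVecs zero xs = [] ∷ []
allVecs (suc N) xs = concatMap (λ v → map (λ a → a ∷ v) xs) (allVecs N xs)

allSigns : (p : ℕ) → List (Maybe (Fin p))
allSigns p = nothing ∷ map just (allFin p)

level : ∀ {p N} → Vec (Maybe (Fin p)) N → Fin p → Subset N
level X i = tabulate λ j → isi (lookup X j)
  where
  isi : Maybe (Fin _) → Bool
  isi nothing = false
  isi (just c) = does (c ≟ i)

maxList : List ℕ → ℕ
maxList = foldr _⊔_ 0

-- alt_p(G, τ, q) = max { alt(X) : X ∈ (Z_p ∪ {0})^N, |E(G[τ(X^i)])| ≤ q-1 ∀ i }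
-- (G a hypergraph whose vertex set is the image of τ : [N] → G's ambient Fin n;
--  |E(G[τ(X^i)])| ≤ q - 1 is written as < q, q being positive)
altP : ∀ {n N} → (p : ℕ) → Hypergraph n → (Fin N → Fin n) → (q : ℕ) → ℕ
altP {n} {N} p G τ q =
  maxList (map alt (filterᵇ admissible (allVecs N (allSigns p))))
  where
  admissible : Vec (Maybe (Fin p)) N → Bool
  admissible X = all (λ i → numEdgesIn G (image τ (level X i)) <ᵇ q) (allFin p)

-- 𝒯_{H,C,s,σ}: M is an edge iff M ≠ ∅ and |M| - alt_s(H[M], σ_M, q) > (s-1)C
-- (written as (s-1)C + alt < |M| to avoid truncated subtraction)
Tgraph : ∀ {n} → Hypergraph n → (C s q : ℕ) → (Fin n → Fin n) → Hypergraph n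
Tgraph H C s q σ = record { isEdge = λ M →
  (0 <ᵇ ∣ M ∣) ∧ (((s ∸ 1) * C + altP s (induced H M) (restrictBij σ M) q) <ᵇ ∣ M ∣) }

-- Let X be an r-colouring admissible for 𝒯 with q = 1 and let M i = σ(X^i). No M i is an edge of 𝒯, so
-- |X^i| = |M i| ≤ (s-1)C + alt_s(H[M i], σ_{M i}, q), and alt X ≤ Σ_i |X^i| is at most r(s-1)C plus the
-- sum of these alternation numbers. For that sum, merge optimal s-colourings Y i of the sets M i into one
-- rs-colouring Z of V(H) whose colour class (i, c) is the colour class c of Y i. Each colour class of Z lies in
-- a colour class of some Y i, so Z is admissible for H with q, and alternating subsequences of the Y i
-- interleave to one of Z, so Σ_i alt(Y i) ≤ alt Z ≤ alt_rs(H, σ, q).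
module Submission where

open import Defs

open import Data.Bool using (Bool; true; false; T; T?; _∧_; not; _∨_; if_then_else_)
open import Data.Bool.ListAction using (all; any)
open import Data.Bool.Properties using (T-∧; T-≡)
open import Data.Empty using (⊥-elim)
open import Data.Fin using (Fin; zero; suc; _≟_; quotient; remainder; combine)
import Data.Fin.Properties as Fin
open import Data.Fin.Properties using (remQuot-combine)
open import Data.Fin.Subset using (Subset; inside; outside; _∈_; _∉_; _⊆_; _-_; ∣_∣; ⊥)
open import Data.Fin.Subset.Properties
  using (⊥⊆; drop-there; ∣p∣≤∣x∷p∣; p⊆q⇒∣p∣≤∣q∣; x∈p⇒∣p-x∣<∣p∣; x∈p∧x≢y⇒x∈p-y)
open import Data.List using (List; []; _∷_; map; filterᵇ; length; allFin; zip)
import Data.List as List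
open import Data.List.Membership.Propositional using () renaming (_∈_ to _∈ˡ_)
open import Data.List.Membership.Propositional.Properties
  using (∈-map⁺; ∈-map⁻; ∈-concatMap⁺; ∈-allFin; ∈-filter⁺; ∈-filter⁻; foldr-selective)
open import Data.List.Properties using (length-map)
open import Data.List.Relation.Binary.Sublist.Heterogeneous.Properties using (length-mono-≤)
open import Data.List.Relation.Binary.Sublist.Propositional using (⊆-refl)
open import Data.List.Relation.Binary.Sublist.Propositional.Properties using (filter⁺)
import Data.List.Relation.Unary.All as All
open import Data.List.Relation.Unary.All.Properties using (all⁺; all⁻)
open import Data.List.Relation.Unary.Any using (here; there)
import Data.List.Relation.Unary.Any as Any
open import Data.List.Relation.Unary.Any.Properties using (any⁺; any⁻)
open import Data.Maybe using (Maybe; just; nothing)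
import Data.Maybe as Maybe
open import Data.Maybe.Properties using (≡-dec; just-injective)
open import Data.Nat using (ℕ; zero; suc; _+_; _*_; _∸_; _≤_; _<_; _⊔_; _<ᵇ_; _<?_; z≤n; s≤s)
open import Data.Nat.Properties hiding (_≟_)
open import Algebra.Properties.CommutativeSemigroup +-commutativeSemigroup
  using (xy∙z≈xz∙y; interchange)
open import Data.Product using (∃-syntax; _×_; _,_; proj₁; proj₂; uncurry)
open import Data.Sum using (inj₁; inj₂)
open import Data.Vec using (Vec; []; _∷_; here; there; lookup; toList; tabulate; replicate)
import Data.Vec as Vec
open import Data.Vec.Functional using (updateAt)
open import Data.Vec.Functional.Properties using (updateAt-updates; updateAt-minimal)
open import Data.Vec.Properties
  using ( lookup∘tabulate; tabulate∘lookup; tabulate-cong; tabulate-∘; lookup-replicate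
        ; toList-map; length-toList; []=⇒lookup; lookup⇒[]=)
open import Function using (id; _∘_; const; flip; case_of_; Equivalence)
open import Function.Bundles using (_⤖_; Bijection)
open import Function.Definitions using (Injective)
open import Relation.Binary.PropositionalEquality
open import Relation.Nullary using (does; yes; no; ¬_)
open import Relation.Nullary.Decidable using (dec-true; dec-false)

∑ : (k : ℕ) → (Fin k → ℕ) → ℕ
∑ zero    f = 0
∑ (suc k) f = f zero + ∑ k (f ∘ suc)

∑-mono-≤ : ∀ k {f g : Fin k → ℕ} → (∀ i → f i ≤ g i) → ∑ k f ≤ ∑ k g
∑-mono-≤ zero    f≤g = z≤n
∑-mono-≤ (suc k) f≤g = +-mono-≤ (f≤g zero) (∑-mono-≤ k (f≤g ∘ suc))

∑-const : ∀ k a → ∑ k (const a) ≡ k * a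
∑-const zero    a = refl
∑-const (suc k) a = cong (a +_) (∑-const k a)

∑-cong : ∀ k {f g : Fin k → ℕ} → (∀ i → f i ≡ g i) → ∑ k f ≡ ∑ k g
∑-cong zero    f≗g = refl
∑-cong (suc k) f≗g = cong₂ _+_ (f≗g zero) (∑-cong k (f≗g ∘ suc))

∑-zero : ∀ k → ∑ k (const 0) ≡ 0
∑-zero zero    = refl
∑-zero (suc k) = ∑-zero k

∑-+ : ∀ k (f g : Fin k → ℕ) → ∑ k (λ i → f i + g i) ≡ ∑ k f + ∑ k g
∑-+ zero    f g = refl
∑-+ (suc k) f g = trans (cong (f zero + g zero +_) (∑-+ k (f ∘ suc) (g ∘ suc)))
                        (interchange (f zero) (g zero) _ _)

∑-mono-except : ∀ k {f g : Fin k → ℕ} (i : Fin k) {a b} →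
  (∀ j → j ≢ i → f j ≤ g j) → f i + a ≤ g i + b → ∑ k f + a ≤ ∑ k g + b
∑-mono-except (suc k) {f} {g} zero {a} {b} f≤g fa≤gb = begin
  f zero + ∑ k (f ∘ suc) + a  ≡⟨ xy∙z≈xz∙y (f zero) _ a ⟩
  f zero + a + ∑ k (f ∘ suc)  ≤⟨ +-mono-≤ fa≤gb (∑-mono-≤ k (λ j → f≤g (suc j) λ ())) ⟩
  g zero + b + ∑ k (g ∘ suc)  ≡⟨ xy∙z≈xz∙y (g zero) _ b ⟨
  g zero + ∑ k (g ∘ suc) + b  ∎
  where open ≤-Reasoning
∑-mono-except (suc k) {f} {g} (suc i) {a} {b} f≤g fa≤gb = begin
  f zero + ∑ k (f ∘ suc) + a    ≡⟨ +-assoc (f zero) _ a ⟩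
  f zero + (∑ k (f ∘ suc) + a)  ≤⟨ +-mono-≤ (f≤g zero λ ()) (∑-mono-except k i f≤g′ fa≤gb) ⟩
  g zero + (∑ k (g ∘ suc) + b)  ≡⟨ +-assoc (g zero) _ b ⟨
  g zero + ∑ k (g ∘ suc) + b    ∎
  where
  open ≤-Reasoning
  f≤g′ : ∀ j → j ≢ i → f (suc j) ≤ g (suc j)
  f≤g′ j j≢i = f≤g (suc j) (j≢i ∘ Fin.suc-injective)

≤-maxList : ∀ {n ns} → n ∈ˡ ns → n ≤ maxList ns
≤-maxList (here refl)  = m≤m⊔n _ _
≤-maxList (there n∈ns) = ≤-trans (≤-maxList n∈ns) (m≤n⊔m _ _)

maxList-≤ : ∀ {b} ns → (∀ {n} → n ∈ˡ ns → n ≤ b) → maxList ns ≤ b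
maxList-≤ []       ns≤b = z≤n
maxList-≤ (n ∷ ns) ns≤b = ⊔-lub (ns≤b (here refl)) (maxList-≤ ns (ns≤b ∘ there))

-- maxList returns its junk value 0 only when it is a genuine maximum anyway.
maxList-∈ : ∀ {n ns} → n ∈ˡ ns → maxList ns ∈ˡ ns
maxList-∈ {n} {ns} n∈ns with foldr-selective ⊔-sel 0 ns
... | inj₂ max∈ns = max∈ns
... | inj₁ max≡0  = subst (_∈ˡ ns) n≡max n∈ns
  where
  n≡max : n ≡ maxList ns
  n≡max = trans (n≤0⇒n≡0 (≤-trans (≤-maxList n∈ns) (≤-reflexive max≡0))) (sym max≡0)

∈-allSubsets : ∀ {n} (S : Subset n) → S ∈ˡ allSubsets n
∈-allSubsets []      = here refl
∈-allSubsets (b ∷ S) = ∈-concatMap⁺ (λ S → (inside ∷ S) ∷ (outside ∷ S) ∷ [])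
  (Any.map (λ { refl → ∈-extensions b }) (∈-allSubsets S))
  where
  ∈-extensions : ∀ b → (b ∷ S) ∈ˡ (inside ∷ S) ∷ (outside ∷ S) ∷ []
  ∈-extensions true  = here refl
  ∈-extensions false = there (here refl)

∈-allVecs : ∀ {A : Set} {xs : List A} → (∀ a → a ∈ˡ xs) → ∀ {N} (V : Vec A N) → V ∈ˡ allVecs N xs
∈-allVecs ∈xs []      = here refl
∈-allVecs ∈xs (a ∷ V) = ∈-concatMap⁺ (λ v → map (_∷ v) _)
  (Any.map (λ { refl → ∈-map⁺ (_∷ V) (∈xs a) }) (∈-allVecs ∈xs V))

∈-allSigns : ∀ {p} (a : Maybe (Fin p)) → a ∈ˡ allSigns p
∈-allSigns nothing  = here refl
∈-allSigns (just c) = there (∈-map⁺ just (∈-allFin c))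

module _ {n N} (p : ℕ) (G : Hypergraph n) (τ : Fin N → Fin n) (q : ℕ) where

  Admissible : Vec (Maybe (Fin p)) N → Set
  Admissible X = ∀ c → numEdgesIn G (image τ (level X c)) < q

  private
    admissibleᵇ : Vec (Maybe (Fin p)) N → Bool
    admissibleᵇ X = all (λ c → numEdgesIn G (image τ (level X c)) <ᵇ q) (allFin p)

    admissibles : List (Vec (Maybe (Fin p)) N)
    admissibles = filterᵇ admissibleᵇ (allVecs N (allSigns p))

    ∈-admissibles⁺ : ∀ {X} → Admissible X → X ∈ˡ admissibles
    ∈-admissibles⁺ {X} adm = ∈-filter⁺ (T? ∘ admissibleᵇ) (∈-allVecs ∈-allSigns X)
      (all⁻ _ {xs = allFin p} (All.tabulate (λ {c} _ → <⇒<ᵇ (adm c))))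

    ∈-admissibles⁻ : ∀ {X} → X ∈ˡ admissibles → Admissible X
    ∈-admissibles⁻ {X} X∈ c = <ᵇ⇒< _ q (All.lookup (all⁺ _ (allFin p) admissibleᵇX) (∈-allFin c))
      where
      admissibleᵇX : T (admissibleᵇ X)
      admissibleᵇX = proj₂ (∈-filter⁻ (T? ∘ admissibleᵇ) {xs = allVecs N (allSigns p)} X∈)

  alt≤altP : ∀ X → Admissible X → alt X ≤ altP p G τ q
  alt≤altP X adm = ≤-maxList (∈-map⁺ alt (∈-admissibles⁺ {X} adm))

  altP-≤ : ∀ {b} → (∀ X → Admissible X → alt X ≤ b) → altP p G τ q ≤ b
  altP-≤ alt≤b = maxList-≤ (map alt admissibles) λ a∈ →
    let X , X∈ , a≡altX = ∈-map⁻ alt a∈ in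
    subst (_≤ _) (sym a≡altX) (alt≤b X (∈-admissibles⁻ X∈))

  altP-attained : ∀ X → Admissible X → ∃[ Y ] Admissible Y × alt Y ≡ altP p G τ q
  altP-attained X adm =
    let Y , Y∈ , max≡altY = ∈-map⁻ alt (maxList-∈ (∈-map⁺ alt (∈-admissibles⁺ {X} adm))) in
    Y , ∈-admissibles⁻ Y∈ , sym max≡altY

T⇒∈ : ∀ {n} {S : Subset n} {j} → T (lookup S j) → j ∈ S
T⇒∈ {S = S} {j} t = lookup⇒[]= j S (Equivalence.to T-≡ t)

∈⇒T : ∀ {n} {S : Subset n} {j} → j ∈ S → T (lookup S j)
∈⇒T j∈S = Equivalence.from T-≡ ([]=⇒lookup j∈S)

⊆ᵇ⇒⊆ : ∀ {n} {A B : Subset n} → T (A ⊆ᵇ B) → A ⊆ B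
⊆ᵇ⇒⊆ {A = true ∷ A} {true ∷ B} A⊆B here        = here
⊆ᵇ⇒⊆ {A = a ∷ A}    {b ∷ B}    A⊆B (there x∈A) =
  there (⊆ᵇ⇒⊆ (proj₂ (Equivalence.to (T-∧ {not a ∨ b}) A⊆B)) x∈A)

⊆⇒⊆ᵇ : ∀ {n} {A B : Subset n} → A ⊆ B → T (A ⊆ᵇ B)
⊆⇒⊆ᵇ {A = []}        {[]}    A⊆B = _
⊆⇒⊆ᵇ {A = false ∷ A} {b ∷ B} A⊆B = ⊆⇒⊆ᵇ (drop-there ∘ A⊆B ∘ there)
⊆⇒⊆ᵇ {A = true ∷ A}  {b ∷ B} A⊆B with A⊆B here
... | here = ⊆⇒⊆ᵇ (drop-there ∘ A⊆B ∘ there)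

module _ {N n} (τ : Fin N → Fin n) where

  ∈-image⁺ : ∀ {S j} → j ∈ S → τ j ∈ image τ S
  ∈-image⁺ {S} {j} j∈S =
    T⇒∈ (subst T (sym (lookup∘tabulate _ (τ j))) (any⁺ _ (Any.map (λ { refl → witness }) (∈-allFin j))))
    where
    witness : T (lookup S j ∧ does (τ j ≟ τ j))
    witness = Equivalence.from T-∧ (∈⇒T j∈S , Equivalence.from T-≡ (dec-true (τ j ≟ τ j) refl))

  ∈-image⁻ : ∀ {S v} → v ∈ image τ S → ∃[ j ] j ∈ S × τ j ≡ v
  ∈-image⁻ {S} {v} v∈ = uncurry witness
    (Any.satisfied (any⁻ _ (allFin N) (subst T (lookup∘tabulate _ v) (∈⇒T v∈))))
    where
    witness : ∀ j → T (lookup S j ∧ does (τ j ≟ v)) → ∃[ j ] j ∈ S × τ j ≡ v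
    witness j t with τ j ≟ v | Equivalence.to (T-∧ {lookup S j}) t
    ... | yes τj≡v | j∈S , _ = j , T⇒∈ j∈S , τj≡v

  ∈-preimage⁺ : ∀ {M i} → τ i ∈ M → i ∈ preimage τ M
  ∈-preimage⁺ {M} {i} τi∈M = lookup⇒[]= i _ (trans (lookup∘tabulate _ i) ([]=⇒lookup τi∈M))

  ∈-preimage⁻ : ∀ {M i} → i ∈ preimage τ M → τ i ∈ M
  ∈-preimage⁻ {M} {i} i∈ = lookup⇒[]= (τ i) M (trans (sym (lookup∘tabulate _ i)) ([]=⇒lookup i∈))

∣preimage∣≤∣∣ : ∀ {m n} (f : Fin m → Fin n) → Injective _≡_ _≡_ f → ∀ M → ∣ preimage f M ∣ ≤ ∣ M ∣
∣preimage∣≤∣∣ {zero}  f f-inj M = z≤n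
∣preimage∣≤∣∣ {suc m} f f-inj M with lookup M (f zero) in f0∈M
... | false = ∣preimage∣≤∣∣ (f ∘ suc) (Fin.suc-injective ∘ f-inj) M
... | true  = begin-strict
  ∣ preimage (f ∘ suc) M ∣
    ≤⟨ p⊆q⇒∣p∣≤∣q∣ (∈-preimage⁺ (f ∘ suc) ∘ avoid-f0 ∘ ∈-preimage⁻ (f ∘ suc)) ⟩
  ∣ preimage (f ∘ suc) (M - f zero) ∣
    ≤⟨ ∣preimage∣≤∣∣ (f ∘ suc) (Fin.suc-injective ∘ f-inj) (M - f zero) ⟩
  ∣ M - f zero ∣
    <⟨ x∈p⇒∣p-x∣<∣p∣ (lookup⇒[]= (f zero) M f0∈M) ⟩
  ∣ M ∣                                 ∎
  where
  open ≤-Reasoning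
  avoid-f0 : ∀ {i} → f (suc i) ∈ M → f (suc i) ∈ M - f zero
  avoid-f0 fi∈M = x∈p∧x≢y⇒x∈p-y fi∈M (λ fi≡f0 → Fin.0≢1+n (f-inj (sym fi≡f0)))

length-elems : ∀ {n} (S : Subset n) → length (elems S) ≡ ∣ S ∣
length-elems []          = refl
length-elems (true ∷ S)  = cong suc (trans (length-map suc (elems S)) (length-elems S))
length-elems (false ∷ S) = trans (length-map suc (elems S)) (length-elems S)

∈-level⁺ : ∀ {p N} (X : Vec (Maybe (Fin p)) N) {c j} → lookup X j ≡ just c → j ∈ level X c
∈-level⁺ (just d ∷ X) {c} {zero}  refl with c ≟ c
... | yes _  = here
... | no c≢c = ⊥-elim (c≢c refl)
∈-level⁺ (x ∷ X)      {c} {suc j} Xj≡c = there (∈-level⁺ X Xj≡c)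

∈-level⁻ : ∀ {p N} (X : Vec (Maybe (Fin p)) N) {c j} → j ∈ level X c → lookup X j ≡ just c
∈-level⁻ (just d ∷ X) {c} {zero}  j∈ with d ≟ c | j∈
... | yes refl | here = refl
∈-level⁻ (x ∷ X)      {c} {suc j} (there j∈) = ∈-level⁻ X j∈

length-filterᵇ-mono : ∀ {A : Set} {p q : A → Bool} → (∀ {x} → T (p x) → T (q x)) →
  ∀ xs → length (filterᵇ p xs) ≤ length (filterᵇ q xs)
length-filterᵇ-mono {p = p} {q} p⇒q xs =
  length-mono-≤ (filter⁺ (T? ∘ p) (T? ∘ q) (λ { refl → p⇒q }) (⊆-refl {x = xs}))

numEdgesIn-mono : ∀ {n} {G G′ : Hypergraph n} {A B : Subset n} →
  (∀ {E} → T (isEdge G E) → E ⊆ A → T (isEdge G′ E) × E ⊆ B) →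
  numEdgesIn G A ≤ numEdgesIn G′ B
numEdgesIn-mono {n} {G} {G′} {A} {B} step = length-filterᵇ-mono edge⇒edge (allSubsets n)
  where
  edge⇒edge : ∀ {E} → T (isEdge G E ∧ (E ⊆ᵇ A)) → T (isEdge G′ E ∧ (E ⊆ᵇ B))
  edge⇒edge {E} t =
    let e , E⊆A = Equivalence.to (T-∧ {isEdge G E}) t
        e′ , E⊆B = step e (⊆ᵇ⇒⊆ E⊆A)
    in Equivalence.from T-∧ (e′ , ⊆⇒⊆ᵇ E⊆B)

isEdge⇒0<numEdgesIn : ∀ {n} (G : Hypergraph n) {S} → T (isEdge G S) → 0 < numEdgesIn G S
isEdge⇒0<numEdgesIn G {S} e = nonempty (∈-filter⁺ (T? ∘ (λ E → isEdge G E ∧ (E ⊆ᵇ S)))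
  (∈-allSubsets S) (Equivalence.from T-∧ (e , ⊆⇒⊆ᵇ {A = S} id)))
  where
  nonempty : ∀ {A : Set} {x : A} {xs} → x ∈ˡ xs → 0 < length xs
  nonempty (here _)  = s≤s z≤n
  nonempty (there _) = s≤s z≤n

module _ {p : ℕ} where

  altFrom-skip : ∀ b x (xs : List (Maybe (Fin p))) → altFrom b xs ≤ altFrom b (x ∷ xs)
  altFrom-skip b        nothing  xs = ≤-refl
  altFrom-skip nothing  (just c) xs = m≤m⊔n _ _
  altFrom-skip (just d) (just c) xs with c ≟ d
  ... | yes _ = ≤-refl
  ... | no  _ = m≤m⊔n _ _

  altFrom-take : ∀ {b c} (xs : List (Maybe (Fin p))) → b ≢ just c →
    suc (altFrom (just c) xs) ≤ altFrom b (just c ∷ xs)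
  altFrom-take {nothing}     xs b≢c = m≤n⊔m _ _
  altFrom-take {just d} {c} xs b≢c with c ≟ d
  ... | yes refl = ⊥-elim (b≢c refl)
  ... | no  _    = m≤n⊔m _ _

  altFrom-repeat : ∀ c (xs : List (Maybe (Fin p))) → altFrom (just c) (just c ∷ xs) ≡ altFrom (just c) xs
  altFrom-repeat c xs with c ≟ c
  ... | yes _  = refl
  ... | no c≢c = ⊥-elim (c≢c refl)

  altFrom-∷≤ : ∀ b c (xs : List (Maybe (Fin p))) →
    altFrom b (just c ∷ xs) ≤ altFrom b xs ⊔ suc (altFrom (just c) xs)
  altFrom-∷≤ nothing  c xs = ≤-refl
  altFrom-∷≤ (just d) c xs with c ≟ d
  ... | yes _ = m≤m⊔n _ _
  ... | no  _ = ≤-refl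

  altFrom-resume : ∀ b c (xs : List (Maybe (Fin p))) → altFrom (just c) xs ≤ altFrom b (just c ∷ xs)
  altFrom-resume b c xs with ≡-dec _≟_ b (just c)
  ... | yes refl = ≤-reflexive (sym (altFrom-repeat c xs))
  ... | no  b≢c  = ≤-trans (n≤1+n _) (altFrom-take xs b≢c)

  -- If an alternating subsequence begins with b′, its tail begins with a term other than b′.
  altFrom-restart : ∀ b b′ (xs : List (Maybe (Fin p))) → altFrom b xs ≤ suc (altFrom b′ xs)
  altFrom-restart b b′ []              = z≤n
  altFrom-restart b b′ (nothing  ∷ xs) = altFrom-restart b b′ xs
  altFrom-restart b b′ (just c ∷ xs)   = ≤-trans (altFrom-∷≤ b c xs) (⊔-lub
    (≤-trans (altFrom-restart b b′ xs) (s≤s (altFrom-skip b′ (just c) xs)))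
    (s≤s (altFrom-resume b′ c xs)))

  altFrom-just-∷≤ : ∀ b c (xs : List (Maybe (Fin p))) → altFrom b (just c ∷ xs) ≤ suc (altFrom (just c) xs)
  altFrom-just-∷≤ b c xs = ≤-trans (altFrom-∷≤ b c xs) (⊔-lub (altFrom-restart b (just c) xs) ≤-refl)

  altFrom-∷-cong : ∀ {xs ys : List (Maybe (Fin p))} → (∀ b → altFrom b xs ≡ altFrom b ys) →
    ∀ b y → altFrom b (y ∷ xs) ≡ altFrom b (y ∷ ys)
  altFrom-∷-cong xs≗ys b        nothing  = xs≗ys b
  altFrom-∷-cong xs≗ys nothing  (just c) = cong₂ _⊔_ (xs≗ys nothing) (cong suc (xs≗ys (just c)))
  altFrom-∷-cong xs≗ys (just d) (just c) with c ≟ d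
  ... | yes _ = xs≗ys (just d)
  ... | no  _ = cong₂ _⊔_ (xs≗ys (just d)) (cong suc (xs≗ys (just c)))

altFrom≤∑∣level∣ : ∀ {p N} (X : Vec (Maybe (Fin p)) N) b → altFrom b (toList X) ≤ ∑ p (∣_∣ ∘ level X)
altFrom≤∑∣level∣ {p} []           b = ≤-reflexive (sym (∑-zero p))
altFrom≤∑∣level∣     (nothing ∷ X) b = altFrom≤∑∣level∣ X b
altFrom≤∑∣level∣ {p} (just c ∷ X)  b = begin
  altFrom b (just c ∷ toList X)           ≤⟨ altFrom-just-∷≤ b c (toList X) ⟩
  suc (altFrom (just c) (toList X))       ≤⟨ s≤s (altFrom≤∑∣level∣ X (just c)) ⟩
  suc (∑ p (∣_∣ ∘ level X))               ≡⟨ +-comm 1 _ ⟩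
  ∑ p (∣_∣ ∘ level X) + 1                 ≤⟨ ∑-mono-except p c (λ j _ → ∣p∣≤∣x∷p∣ (does (c ≟ j)) (level X j)) new-c ⟩
  ∑ p (∣_∣ ∘ level (just c ∷ X)) + 0      ≡⟨ +-identityʳ _ ⟩
  ∑ p (∣_∣ ∘ level (just c ∷ X))          ∎
  where
  open ≤-Reasoning
  new-c : ∣ level X c ∣ + 1 ≤ ∣ level (just c ∷ X) c ∣ + 0
  new-c with c ≟ c
  ... | yes _  = ≤-reflexive (trans (+-comm _ 1) (sym (+-identityʳ _)))
  ... | no c≢c = ⊥-elim (c≢c refl)

∈-zip-map₁ : ∀ {A B C : Set} (f : A → C) {xs ys} {x : A} {y : B} →
  (x , y) ∈ˡ zip xs ys → (f x , y) ∈ˡ zip (map f xs) ys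
∈-zip-map₁ f {_ ∷ _} {_ ∷ _} (here refl) = here refl
∈-zip-map₁ f {_ ∷ _} {_ ∷ _} (there xy∈) = there (∈-zip-map₁ f xy∈)

∈-zip-toList : ∀ {A B : Set} (xs : List A) (Y : Vec B (length xs)) {x y} →
  (x , y) ∈ˡ zip xs (toList Y) → ∃[ m ] List.lookup xs m ≡ x × lookup Y m ≡ y
∈-zip-toList (_ ∷ xs) (_ ∷ Y) (here refl) = zero , refl , refl
∈-zip-toList (_ ∷ xs) (_ ∷ Y) (there xy∈) =
  let m , xs[m]≡x , Y[m]≡y = ∈-zip-toList xs Y xy∈ in suc m , xs[m]≡x , Y[m]≡y

scatter : ∀ {n} {A : Set} → Subset n → List (Maybe A) → Vec (Maybe A) n
scatter []          ys       = []
scatter (false ∷ S) ys       = nothing ∷ scatter S ys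
scatter (true ∷ S)  []       = nothing ∷ scatter S []
scatter (true ∷ S)  (y ∷ ys) = y ∷ scatter S ys

altFrom-scatter : ∀ {n p} (S : Subset n) (ys : List (Maybe (Fin p))) → length ys ≡ ∣ S ∣ →
  ∀ b → altFrom b (toList (scatter S ys)) ≡ altFrom b ys
altFrom-scatter []          []       _     b = refl
altFrom-scatter (false ∷ S) ys       ∣ys∣≡ b = altFrom-scatter S ys ∣ys∣≡ b
altFrom-scatter (true ∷ S)  (y ∷ ys) ∣ys∣≡ b =
  altFrom-∷-cong (altFrom-scatter S ys (suc-injective ∣ys∣≡)) b y

scatter-∉ : ∀ {n} {A : Set} (S : Subset n) (ys : List (Maybe A)) {j} → j ∉ S → lookup (scatter S ys) j ≡ nothing
scatter-∉ (false ∷ S) ys       {zero}  _   = refl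
scatter-∉ (true ∷ S)  ys       {zero}  j∉S = ⊥-elim (j∉S here)
scatter-∉ (false ∷ S) ys       {suc j} j∉S = scatter-∉ S ys (j∉S ∘ there)
scatter-∉ (true ∷ S)  []       {suc j} j∉S = scatter-∉ S [] (j∉S ∘ there)
scatter-∉ (true ∷ S)  (y ∷ ys) {suc j} j∉S = scatter-∉ S ys (j∉S ∘ there)

scatter-[] : ∀ {n} {A : Set} (S : Subset n) j → lookup (scatter {A = A} S []) j ≡ nothing
scatter-[] (false ∷ S) zero    = refl
scatter-[] (true ∷ S)  zero    = refl
scatter-[] (false ∷ S) (suc j) = scatter-[] S j
scatter-[] (true ∷ S)  (suc j) = scatter-[] S j

scatter-just : ∀ {n} {A : Set} (S : Subset n) (ys : List (Maybe A)) {j y} →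
  lookup (scatter S ys) j ≡ just y → (j , just y) ∈ˡ zip (elems S) ys
scatter-just (false ∷ S) ys       {suc j} eq   = ∈-zip-map₁ suc (scatter-just S ys eq)
scatter-just (true ∷ S)  []       {suc j} eq   with () ← trans (sym eq) (scatter-[] S j)
scatter-just (true ∷ S)  (y ∷ ys) {zero}  refl = here refl
scatter-just (true ∷ S)  (y ∷ ys) {suc j} eq   = there (∈-zip-map₁ suc (scatter-just S ys eq))

module _ {r s : ℕ} where

  project : Fin r → Maybe (Fin (r * s)) → Maybe (Fin s)
  project k nothing  = nothing
  project k (just w) = if does (k ≟ quotient s w) then just (remainder {r} s w) else nothing

  project-quotient : ∀ w → project (quotient s w) (just w) ≡ just (remainder {r} s w)
  project-quotient w rewrite dec-true (quotient {r} s w ≟ quotient s w) refl = refl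

  project-other : ∀ {k} w → k ≢ quotient s w → project k (just w) ≡ nothing
  project-other {k} w k≢i rewrite dec-false (k ≟ quotient s w) k≢i = refl

  -- Alternating subsequences of the projections interleave to one of zs: the predecessor of a term in the
  -- interleaving lies either in another class or in the same class, where it is its predecessor there.
  -- from k is the last colour used in class k, which must agree with the last term b of zs.
  ∑-altFrom-project≤altFrom : ∀ (zs : List (Maybe (Fin (r * s)))) b (from : Fin r → Maybe (Fin s)) →
    (∀ {w} → b ≡ just w → from (quotient s w) ≡ just (remainder {r} s w)) →
    ∑ r (λ k → altFrom (from k) (map (project k) zs)) ≤ altFrom b zs
  ∑-altFrom-project≤altFrom []            b from inv = ≤-reflexive (∑-zero r)
  ∑-altFrom-project≤altFrom (nothing ∷ zs) b from inv = ∑-altFrom-project≤altFrom zs b from inv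
  ∑-altFrom-project≤altFrom (just w ∷ zs)  b from inv with ≡-dec _≟_ b (just w)
  ... | yes refl = begin
    ∑ r (λ k → altFrom (from k) (project k (just w) ∷ rest k))  ≤⟨ ∑-mono-≤ r unchanged ⟩
    ∑ r (λ k → altFrom (from k) (rest k))                       ≤⟨ ∑-altFrom-project≤altFrom zs b from inv ⟩
    altFrom b zs                                                 ≤⟨ altFrom-skip b (just w) zs ⟩
    altFrom b (just w ∷ zs)                                      ∎
    where
    open ≤-Reasoning
    rest : Fin r → List (Maybe (Fin s))
    rest k = map (project k) zs
    unchanged : ∀ k → altFrom (from k) (project k (just w) ∷ rest k) ≤ altFrom (from k) (rest k)
    unchanged k with k ≟ quotient s w
    ... | no _     = ≤-refl
    ... | yes refl rewrite inv refl = ≤-reflexive (altFrom-repeat _ (rest k))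
  ... | no b≢w = begin
    ∑ r (λ k → altFrom (from k) (project k (just w) ∷ rest k))       ≡⟨ +-identityʳ _ ⟨
    ∑ r (λ k → altFrom (from k) (project k (just w) ∷ rest k)) + 0   ≤⟨ ∑-mono-except r i others at-i ⟩
    ∑ r (λ k → altFrom (from′ k) (rest k)) + 1
      ≤⟨ +-monoˡ-≤ 1 (∑-altFrom-project≤altFrom zs (just w) from′ inv′) ⟩
    altFrom (just w) zs + 1                                           ≡⟨ +-comm _ 1 ⟩
    suc (altFrom (just w) zs)                                         ≤⟨ altFrom-take zs b≢w ⟩
    altFrom b (just w ∷ zs)                                           ∎
    where
    open ≤-Reasoning
    i = quotient s w
    c = remainder {r} s w
    rest : Fin r → List (Maybe (Fin s))
    rest k = map (project k) zs
    from′ : Fin r → Maybe (Fin s)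
    from′ = updateAt from i (const (just c))
    inv′ : ∀ {w′} → just w ≡ just w′ → from′ (quotient s w′) ≡ just (remainder {r} s w′)
    inv′ refl = updateAt-updates i from
    others : ∀ k → k ≢ i → altFrom (from k) (project k (just w) ∷ rest k) ≤ altFrom (from′ k) (rest k)
    others k k≢i rewrite project-other w k≢i | updateAt-minimal k i {const (just c)} from k≢i = ≤-refl
    at-i : altFrom (from i) (project i (just w) ∷ rest i) + 0 ≤ altFrom (from′ i) (rest i) + 1
    at-i rewrite project-quotient w | updateAt-updates i {const (just c)} from | +-identityʳ (altFrom (from i) (just c ∷ rest i)) =
      ≤-trans (altFrom-just-∷≤ (from i) c (rest i)) (≤-reflexive (+-comm 1 _))

  quotient-combine : ∀ (i : Fin r) (c : Fin s) → quotient s (combine i c) ≡ i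
  quotient-combine i c = cong proj₁ (remQuot-combine i c)

  remainder-combine : ∀ (i : Fin r) (c : Fin s) → remainder {r} s (combine i c) ≡ c
  remainder-combine i c = cong proj₂ (remQuot-combine i c)

  project-combine : ∀ i (y : Maybe (Fin s)) → project i (Maybe.map (combine i) y) ≡ y
  project-combine i nothing  = refl
  project-combine i (just c) =
    subst₂ (λ k d → project k (just (combine i c)) ≡ just d)
      (quotient-combine i c) (remainder-combine i c) (project-quotient (combine i c))

  project-combine-other : ∀ {k i} → k ≢ i → (y : Maybe (Fin s)) → project k (Maybe.map (combine i) y) ≡ nothing
  project-combine-other k≢i nothing  = refl
  project-combine-other {i = i} k≢i (just c) =
    project-other (combine i c) (k≢i ∘ flip trans (quotient-combine i c))

-- Y i colours the elements of P i in increasing order; merged gives such an element coloured c the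
-- product colour combine i c.
module Merge {r s n} (X : Vec (Maybe (Fin r)) n) (P : Fin r → Subset n) (P⊆level : ∀ i → P i ⊆ level X i)
             (Y : ∀ i → Vec (Maybe (Fin s)) (length (elems (P i)))) where

  spreadY : Fin r → Vec (Maybe (Fin s)) n
  spreadY i = scatter (P i) (toList (Y i))

  colourAt : Fin n → Maybe (Fin (r * s))
  colourAt j with lookup X j
  ... | nothing = nothing
  ... | just i  = Maybe.map (combine i) (lookup (spreadY i) j)

  merged : Vec (Maybe (Fin (r * s))) n
  merged = tabulate colourAt

  spreadY-outside : ∀ {k j} → lookup X j ≢ just k → lookup (spreadY k) j ≡ nothing
  spreadY-outside {k} Xj≢k = scatter-∉ (P k) _ (Xj≢k ∘ ∈-level⁻ X ∘ P⊆level k)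

  project-colourAt : ∀ k j → project k (colourAt j) ≡ lookup (spreadY k) j
  project-colourAt k j with lookup X j in Xj≡
  ... | nothing = sym (spreadY-outside λ Xj≡k → case trans (sym Xj≡) Xj≡k of λ ())
  ... | just i with k ≟ i
  ...   | yes refl = project-combine k (lookup (spreadY k) j)
  ...   | no k≢i   = trans (project-combine-other k≢i (lookup (spreadY i) j))
                           (sym (spreadY-outside (k≢i ∘ sym ∘ just-injective ∘ trans (sym Xj≡))))

  toList-spreadY : ∀ k → toList (spreadY k) ≡ map (project k) (toList merged)
  toList-spreadY k = begin
    toList (spreadY k)                        ≡⟨ cong toList (tabulate∘lookup (spreadY k)) ⟨
    toList (tabulate (lookup (spreadY k)))    ≡⟨ cong toList (tabulate-cong (sym ∘ project-colourAt k)) ⟩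
    toList (tabulate (project k ∘ colourAt))  ≡⟨ cong toList (tabulate-∘ (project k) colourAt) ⟩
    toList (Vec.map (project k) merged)       ≡⟨ toList-map (project k) merged ⟩
    map (project k) (toList merged)           ∎
    where open ≡-Reasoning

  ∑alt≤alt-merged : ∑ r (alt ∘ Y) ≤ alt merged
  ∑alt≤alt-merged = begin
    ∑ r (alt ∘ Y)                                                  ≡⟨ ∑-cong r alt-spreadY ⟩
    ∑ r (λ i → altFrom nothing (map (project i) (toList merged)))
      ≤⟨ ∑-altFrom-project≤altFrom {r} {s} (toList merged) nothing (const nothing) (λ ()) ⟩
    alt merged                                                     ∎
    where
    open ≤-Reasoning
    alt-spreadY : ∀ i → alt (Y i) ≡ altFrom nothing (map (project i) (toList merged))
    alt-spreadY i = begin-equality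
      altFrom nothing (toList (Y i))
        ≡⟨ altFrom-scatter (P i) (toList (Y i)) (trans (length-toList (Y i)) (length-elems (P i))) nothing ⟨
      altFrom nothing (toList (spreadY i))
        ≡⟨ cong (altFrom nothing) (toList-spreadY i) ⟩
      altFrom nothing (map (project i) (toList merged))  ∎

  lookup-merged-just : ∀ {j w} → lookup merged j ≡ just w →
    lookup X j ≡ just (quotient s w) ×
    ∃[ m ] List.lookup (elems (P (quotient s w))) m ≡ j × lookup (Y (quotient s w)) m ≡ just (remainder {r} s w)
  lookup-merged-just {j} merged[j]≡w = colourAt-just (trans (sym (lookup∘tabulate colourAt j)) merged[j]≡w)
    where
    colourAt-just : ∀ {w} → colourAt j ≡ just w →
      lookup X j ≡ just (quotient s w) ×
      ∃[ m ] List.lookup (elems (P (quotient s w))) m ≡ j × lookup (Y (quotient s w)) m ≡ just (remainder {r} s w)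
    colourAt-just eq with lookup X j
    ... | just i with lookup (spreadY i) j in spreadYj≡
    ...   | just c with refl ← eq rewrite quotient-combine i c | remainder-combine i c =
      refl , ∈-zip-toList (elems (P i)) (Y i) (scatter-just (P i) (toList (Y i)) spreadYj≡)

∣∣≤∣image∣ : ∀ {m n} (τ : Fin m → Fin n) → Injective _≡_ _≡_ τ → ∀ S → ∣ S ∣ ≤ ∣ image τ S ∣
∣∣≤∣image∣ τ τ-inj S =
  ≤-trans (p⊆q⇒∣p∣≤∣q∣ {p = S} (∈-preimage⁺ τ ∘ ∈-image⁺ τ)) (∣preimage∣≤∣∣ τ τ-inj (image τ S))

preimage-image⊆ : ∀ {m n} (τ : Fin m → Fin n) → Injective _≡_ _≡_ τ → ∀ {S} → preimage τ (image τ S) ⊆ S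
preimage-image⊆ τ τ-inj j∈ with ∈-image⁻ τ (∈-preimage⁻ τ j∈)
... | j′ , j′∈S , τj′≡τj rewrite τ-inj τj′≡τj = j′∈S

admissible₁⇒¬isEdge : ∀ {p n N} (G : Hypergraph n) (τ : Fin N → Fin n) X → Admissible p G τ 1 X →
  ∀ c → ¬ T (isEdge G (image τ (level X c)))
admissible₁⇒¬isEdge G τ X adm c e = <⇒≱ (adm c) (isEdge⇒0<numEdgesIn G e)

numEdgesIn-induced≤ : ∀ {n} (G : Hypergraph n) M S → numEdgesIn (induced G M) S ≤ numEdgesIn G S
numEdgesIn-induced≤ G M S = numEdgesIn-mono (λ {E} e E⊆S → proj₁ (Equivalence.to (T-∧ {isEdge G E}) e) , E⊆S)

numEdgesIn-⊥≤ : ∀ {n} (G : Hypergraph n) M S → numEdgesIn G ⊥ ≤ numEdgesIn (induced G M) S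
numEdgesIn-⊥≤ G M S = numEdgesIn-mono {G = G} {induced G M} {⊥} {S}
  (λ e E⊆⊥ → Equivalence.from T-∧ (e , ⊆⇒⊆ᵇ (⊥⊆ ∘ E⊆⊥)) , ⊥⊆ ∘ E⊆⊥)

blank-admissible : ∀ {p n N} {G : Hypergraph n} {τ : Fin N → Fin n} {q} →
  numEdgesIn G ⊥ < q → Admissible p G τ q (replicate N nothing)
blank-admissible {N = N} {G} {τ} ⊥-sparse c =
  ≤-<-trans (numEdgesIn-mono {G = G} {A = image τ (level (replicate N nothing) c)} (λ e E⊆ → e , ⊥-elim ∘ empty ∘ E⊆))
    ⊥-sparse
  where
  empty : ∀ {v} → v ∉ image τ (level (replicate N nothing) c)
  empty v∈ with ∈-image⁻ τ v∈
  ... | j , j∈ , _ with () ← trans (sym (lookup-replicate j nothing)) (∈-level⁻ (replicate N nothing) j∈)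

module ClassBounds {n} (H : Hypergraph n) (s q : ℕ) (σ : Fin n → Fin n) where

  altInduced : Subset n → ℕ
  altInduced M = altP s (induced H M) (restrictBij σ M) q

  ¬isEdge-Tgraph⇒∣∣≤ : ∀ C M → ¬ T (isEdge (Tgraph H C s q σ) M) → ∣ M ∣ ≤ (s ∸ 1) * C + altInduced M
  ¬isEdge-Tgraph⇒∣∣≤ C M ¬e = ≮⇒≥ λ B<∣M∣ →
    ¬e (Equivalence.from T-∧ (<⇒<ᵇ (≤-<-trans z≤n B<∣M∣) , <⇒<ᵇ B<∣M∣))

  class : ∀ {r} → Vec (Maybe (Fin r)) n → Fin r → Subset n
  class X i = image σ (level X i)

  module _ (σ-inj : Injective _≡_ _≡_ σ) {r} (X : Vec (Maybe (Fin r)) n) where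

    admissible-Tgraph⇒∣level∣≤ : ∀ C → Admissible r (Tgraph H C s q σ) σ 1 X →
      ∀ i → ∣ level X i ∣ ≤ (s ∸ 1) * C + altInduced (class X i)
    admissible-Tgraph⇒∣level∣≤ C adm i = ≤-trans (∣∣≤∣image∣ σ σ-inj (level X i))
      (¬isEdge-Tgraph⇒∣∣≤ C (class X i) (admissible₁⇒¬isEdge (Tgraph H C s q σ) σ X adm i))

    AdmissibleOnClass : (i : Fin r) → Vec (Maybe (Fin s)) (length (elems (preimage σ (class X i)))) → Set
    AdmissibleOnClass i = Admissible s (induced H (class X i)) (restrictBij σ (class X i)) q

    module _ (Y : ∀ i → Vec (Maybe (Fin s)) (length (elems (preimage σ (class X i)))))
             (Y-admissible : ∀ i → AdmissibleOnClass i (Y i)) where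

      open Merge X (preimage σ ∘ class X) (λ i → preimage-image⊆ σ σ-inj) Y

      image-level-merged⊆ : ∀ w {v} → let i = quotient s w; c = remainder {r} s w in
        v ∈ image σ (level merged w) → v ∈ class X i × v ∈ image (restrictBij σ (class X i)) (level (Y i) c)
      image-level-merged⊆ w v∈ =
        let j , j∈ , σj≡v = ∈-image⁻ σ {S = level merged w} v∈
            Xj≡ , m , elems[m]≡j , Yi[m]≡ = lookup-merged-just (∈-level⁻ merged j∈)
            i = quotient s w
        in subst (_∈ class X i) σj≡v (∈-image⁺ σ (∈-level⁺ X Xj≡)) ,
           subst (_∈ image (restrictBij σ (class X i)) (level (Y i) (remainder {r} s w)))
             (trans (cong σ elems[m]≡j) σj≡v) (∈-image⁺ (restrictBij σ (class X i)) (∈-level⁺ (Y i) Yi[m]≡))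

      merged-admissible : Admissible (r * s) H σ q merged
      merged-admissible w =
        ≤-<-trans (numEdgesIn-mono {G = H} {induced H (class X i)} restrict) (Y-admissible i c)
        where
        i = quotient s w
        c = remainder {r} s w
        restrict : ∀ {E} → T (isEdge H E) → E ⊆ image σ (level merged w) →
          T (isEdge (induced H (class X i)) E) × E ⊆ image (restrictBij σ (class X i)) (level (Y i) c)
        restrict e E⊆ =
          Equivalence.from T-∧ (e , ⊆⇒⊆ᵇ (proj₁ ∘ image-level-merged⊆ w ∘ E⊆)) , proj₂ ∘ image-level-merged⊆ w ∘ E⊆

    -- When the empty set already carries q edges, no colouring is admissible and every altP is 0.
    ∑altInduced≤altP : Fin s → ∑ r (altInduced ∘ class X) ≤ altP (r * s) H σ q
    ∑altInduced≤altP c₀ with numEdgesIn H ⊥ <? q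
    ... | no ⊥-dense = ≤-trans (∑-mono-≤ r {g = const 0} vanishes) (≤-trans (≤-reflexive (∑-zero r)) z≤n)
      where
      vanishes : ∀ i → altInduced (class X i) ≤ 0
      vanishes i = altP-≤ s (induced H (class X i)) (restrictBij σ (class X i)) q λ Y admY →
        ⊥-elim (⊥-dense (≤-<-trans (numEdgesIn-⊥≤ H (class X i) _) (admY c₀)))
    ... | yes ⊥-sparse = begin
      ∑ r (altInduced ∘ class X)   ≡⟨ ∑-cong r (sym ∘ proj₂ ∘ proj₂ ∘ optimal) ⟩
      ∑ r (alt ∘ Y)                ≤⟨ ∑alt≤alt-merged ⟩
      alt merged                   ≤⟨ alt≤altP (r * s) H σ q merged (merged-admissible Y (proj₁ ∘ proj₂ ∘ optimal)) ⟩
      altP (r * s) H σ q           ∎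
      where
      open ≤-Reasoning
      optimal : ∀ i → ∃[ Y ] AdmissibleOnClass i Y × alt Y ≡ altInduced (class X i)
      optimal i = altP-attained s (induced H (class X i)) (restrictBij σ (class X i)) q (replicate _ nothing)
        (blank-admissible {G = induced H (class X i)} {restrictBij σ (class X i)}
          (≤-<-trans (numEdgesIn-induced≤ H (class X i) ⊥) ⊥-sparse))

      Y : ∀ i → Vec (Maybe (Fin s)) (length (elems (preimage σ (class X i))))
      Y = proj₁ ∘ optimal

      open Merge X (preimage σ ∘ class X) (λ i → preimage-image⊆ σ σ-inj) Y

lemma1 : (n : ℕ) (H : Hypergraph n) (r s C q : ℕ) →
    2 ≤ r → 2 ≤ s → 1 ≤ C → 1 ≤ q →
    (σ : Fin n ⤖ Fin n) →
    altP r (Tgraph H C s q (Bijection.to σ)) (Bijection.to σ) 1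
      ≤ r * (s ∸ 1) * C + altP (r * s) H (Bijection.to σ) q
lemma1 n H r s C q _ (s≤s _) _ _ σ = altP-≤ r (Tgraph H C s q τ) τ 1 λ X adm → begin
  alt X                                             ≤⟨ altFrom≤∑∣level∣ X nothing ⟩
  ∑ r (∣_∣ ∘ level X)                               ≤⟨ ∑-mono-≤ r (admissible-Tgraph⇒∣level∣≤ τ-inj X C adm) ⟩
  ∑ r (λ i → (s ∸ 1) * C + altInduced (class X i))  ≡⟨ ∑-+ r _ _ ⟩
  ∑ r (const ((s ∸ 1) * C)) + Σalt X                ≡⟨ cong (_+ Σalt X) (∑-const r _) ⟩
  r * ((s ∸ 1) * C) + Σalt X                        ≡⟨ cong (_+ Σalt X) (*-assoc r (s ∸ 1) C) ⟨
  r * (s ∸ 1) * C + Σalt X                          ≤⟨ +-monoʳ-≤ _ (∑altInduced≤altP τ-inj X zero) ⟩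
  r * (s ∸ 1) * C + altP (r * s) H τ q              ∎
  where
  open ≤-Reasoning
  τ = Bijection.to σ
  τ-inj = Bijection.injective σ
  open ClassBounds H s q τ
  Σalt : Vec (Maybe (Fin r)) n → ℕ
  Σalt X = ∑ r (altInduced ∘ class X)
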